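{- For all planar binary trees $\sigma,\tau\in Y$, $$\varphi(\sigma/\tau)=\varphi(\sigma)*\varphi(\tau),\qquad \varphi(\sigma\backslash\tau)=\varphi(\sigma)\,\underline*\,\varphi(\tau).$$
   Context: Planar binary trees: $Y_0=\{|\}$, $Y_n=\{\sigma\vee\tau:\sigma\in Y_k,\tau\in Y_l,k+l=n-1\}$, $\sigma\vee\tau$ being the tree whose root has left subtree $\sigma$ and right subtree $\tau$. Grafting: $\sigma/\tau$ is obtained by attaching $\sigma$ as the left subtree of the leftmost internal vertex of $\tau$; $\sigma\backslash\tau$ is obtained by attaching $\tau$ as the right subtree of the rightmost internal vertex of $\sigma$; if one of the two trees is $|$, the result is the other tree. Noncrossing partitions: $\mathrm{NCP}_n$ noncrossing partitions of $[n]$, $\mathrm{NCP}_0=\{\emptyset\}$, $|$ the unique element of $\mathrm{NCP}_1$. For $P\in\mathrm{NCP}_m,Q\in\mathrm{NCP}_n$: $P*Q$ is the concatenation (blocks of $P$ and blocks of $Q$ shifted by $m$); $P\,\underline*\,Q$ is obtained from $P*Q$ by merging the block containing $m$ with the block containing $m+n$ (and equals $P*Q$ if $P$ or $Q$ is empty). $\varphi:Y\to\mathrm{NCP}$ is defined by $\varphi(|)=\emptyset$, $\varphi(\sigma\vee\tau)=\varphi(\sigma)*(|\,\underline*\,\varphi(\tau))$. -}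

module Defs where

open import Data.Nat using (ℕ; zero; suc; _+_; _≡ᵇ_)
open import Data.Bool using (if_then_else_)
open import Data.List using (List; []; _∷_; _++_; map; length; last)
open import Data.Maybe using (just; nothing)

data Tree : Set where
  leaf : Tree
  _∨_  : Tree → Tree → Tree

infixr 5 _∨_

size : Tree → ℕ
size leaf    = 0
size (l ∨ r) = suc (size l + size r)

_/_ : Tree → Tree → Tree
σ / leaf         = σ
σ / (leaf ∨ r)   = σ ∨ r
σ / ((a ∨ b) ∨ r) = (σ / (a ∨ b)) ∨ r

_\\_ : Tree → Tree → Tree
leaf           \\ τ = τ
(l ∨ leaf)     \\ τ = l ∨ τ
(l ∨ (a ∨ b))  \\ τ = l ∨ ((a ∨ b) \\ τ)

-- Set partitions of [n] = {1,…,n}, in canonical form: a list of length n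
-- whose i-th entry (i = 1..n) is the least element of the block containing i.
-- Two partitions are equal iff their canonical encodings are equal (≡).
-- ∅ ∈ NCP₀ is [], and | ∈ NCP₁ is 1 ∷ [].
Partition : Set
Partition = List ℕ

∅ₚ : Partition
∅ₚ = []

∣ₚ : Partition
∣ₚ = 1 ∷ []

_*_ : Partition → Partition → Partition
P * Q = P ++ map (λ x → length P + x) Q

relabel : ℕ → ℕ → List ℕ → List ℕ
relabel b a = map (λ x → if x ≡ᵇ b then a else x)

-- P _*_ Q: P * Q with the block containing m and the block containing m+n merged
-- (equal to P * Q if P or Q is empty).  The merged block's least element is the
-- least element a of P's block containing m, and Q's block containing n has
-- (shifted) label b = m + (least element of that block) > a.
_*̲_ : Partition → Partition → Partition
P *̲ Q with last P | last Q
... | just a | just b = P ++ relabel (length P + b) a (map (λ x → length P + x) Q)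
... | _      | _      = P * Q

φ : Tree → Partition
φ leaf    = ∅ₚ
φ (σ ∨ τ) = φ σ * (∣ₚ *̲ φ τ)

{-# OPTIONS --safe #-}
-- Since φ (σ ∨ τ) = φ σ * (| *̲ φ τ), both identities follow by induction (on τ for σ / τ,
-- on σ for σ \ τ) from three associativity laws: (P * Q) * R = P * (Q * R),
-- (P * Q) *̲ R = P * (Q *̲ R) for nonempty Q, and (P *̲ Q) *̲ R = P *̲ (Q *̲ R).
-- In the label encoding P *̲ Q renames the shifted last label |P| + b of Q to the last label a
-- of P.  The last law holds because the labels of R, shifted by |P| + |Q|, never collide with
-- the label |P| + b renamed by the outer merge; this needs every label of φ t to lie in
-- [1, |φ t|], which is preserved by * and *̲.
module Submission where

open import Defs
open import Data.Bool using (true; false; if_then_else_)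
open import Data.List using (List; []; _∷_; _++_; map; length; last)
open import Data.List.Properties
  using (++-assoc; ++-identityʳ; map-++; map-id; map-∘; map-cong; map-cong-local; length-++; length-map; last-map)
open import Data.List.Relation.Unary.All as All using (All; []; _∷_)
open import Data.List.Relation.Unary.All.Properties using (++⁺; map⁺)
open import Data.Maybe using (just; nothing)
import Data.Maybe as Maybe
open import Data.Nat using (ℕ; _+_; _≡ᵇ_; _≤_; _<_; s≤s; z≤n)
open import Data.Nat.Properties
  using (_≟_; +-assoc; +-cancelˡ-≡; ≤-trans; ≤-<-trans; >⇒≢; m≤m+n; m≤n+m; m<m+n; +-monoʳ-≤)
open import Data.Product using (_×_; _,_; proj₂; ∃-syntax; map₂)
open import Function using (_∘_)
open import Relation.Binary.PropositionalEquality
open import Relation.Nullary using (yes; no)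
open import Relation.Nullary.Decidable using (dec-true; dec-false)

open ≡-Reasoning

shift : ℕ → List ℕ → List ℕ
shift k = map (k +_)

rename : ℕ → ℕ → ℕ → ℕ
rename b a x = if x ≡ᵇ b then a else x

rename-self : ∀ b a → rename b a b ≡ a
rename-self b a = cong (if_then a else b) (dec-true (b ≟ b) refl)

rename-other : ∀ {b x} a → x ≢ b → rename b a x ≡ x
rename-other {b} {x} a x≢b = cong (if_then a else x) (dec-false (x ≟ b) x≢b)

rename-shift : ∀ k b a x → k + rename b a x ≡ rename (k + b) (k + a) (k + x)
rename-shift k b a x with x ≟ b
... | yes refl = trans (cong (k +_) (rename-self x a)) (sym (rename-self (k + x) (k + a)))
... | no x≢b   = trans (cong (k +_) (rename-other a x≢b))
                       (sym (rename-other (k + a) (x≢b ∘ +-cancelˡ-≡ k x b)))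

rename-rename : ∀ {u x} w v → x ≢ u → rename u v (rename w u x) ≡ rename w v x
rename-rename {u} {x} w v x≢u with x ≟ w
... | yes refl = trans (cong (rename u v) (rename-self x u))
                       (trans (rename-self u v) (sym (rename-self x v)))
... | no x≢w   = trans (cong (rename u v) (rename-other u x≢w))
                       (trans (rename-other v x≢u) (sym (rename-other v x≢w)))

shift-shift : ∀ m n L → shift m (shift n L) ≡ shift (m + n) L
shift-shift m n L = trans (sym (map-∘ L)) (map-cong (λ x → sym (+-assoc m n x)) L)

shift-relabel : ∀ k b a L → shift k (relabel b a L) ≡ relabel (k + b) (k + a) (shift k L)
shift-relabel k b a L = trans (sym (map-∘ L)) (trans (map-cong (rename-shift k b a) L) (map-∘ L))

relabel-relabel : ∀ {u L} w v → All (_≢ u) L → relabel u v (relabel w u L) ≡ relabel w v L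
relabel-relabel {L = L} w v L∌u =
  trans (sym (map-∘ L)) (map-cong-local (All.map (rename-rename w v) L∌u))

shift-relabel-shift : ∀ p q b c R →
  shift p (relabel (q + c) b (shift q R)) ≡ relabel (p + q + c) (p + b) (shift (p + q) R)
shift-relabel-shift p q b c R = begin
  shift p (relabel (q + c) b (shift q R))             ≡⟨ shift-relabel p (q + c) b (shift q R) ⟩
  relabel (p + (q + c)) (p + b) (shift p (shift q R)) ≡⟨ cong₂ (λ u → relabel u (p + b))
                                                              (sym (+-assoc p q c)) (shift-shift p q R) ⟩
  relabel (p + q + c) (p + b) (shift (p + q) R)       ∎

last-∷ : ∀ {A : Set} (x : A) xs → ∃[ y ] last (x ∷ xs) ≡ just y
last-∷ x []       = x , refl
last-∷ x (y ∷ xs) = last-∷ y xs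

last-++ : ∀ {A : Set} (P : List A) {Q b} → last Q ≡ just b → last (P ++ Q) ≡ just b
last-++ []          e = e
last-++ (x ∷ [])    {y ∷ Q} e = e
last-++ (x ∷ y ∷ P) e = last-++ (y ∷ P) e

last-shift : ∀ k Q {b} → last Q ≡ just b → last (shift k Q) ≡ just (k + b)
last-shift k Q e = trans (last-map (k +_) Q) (cong (Maybe.map (k +_)) e)

All-last : ∀ {A : Set} {P : A → Set} {L b} → All P L → last L ≡ just b → P b
All-last {L = x ∷ []}    (p ∷ []) refl = p
All-last {L = x ∷ y ∷ L} (_ ∷ ps) e    = All-last ps e

*-identityˡ : ∀ Q → [] * Q ≡ Q
*-identityˡ = map-id

*-identityʳ : ∀ P → P * [] ≡ P
*-identityʳ = ++-identityʳ

*̲-identityˡ : ∀ Q → [] *̲ Q ≡ Q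
*̲-identityˡ = map-id

*̲-identityʳ : ∀ P → P *̲ [] ≡ P
*̲-identityʳ P with last P
... | just _  = ++-identityʳ P
... | nothing = ++-identityʳ P

*̲-unfold : ∀ P Q {a b} → last P ≡ just a → last Q ≡ just b →
  P *̲ Q ≡ P ++ relabel (length P + b) a (shift (length P) Q)
*̲-unfold P Q ea eb rewrite ea | eb = refl

length-* : ∀ P Q → length (P * Q) ≡ length P + length Q
length-* P Q = trans (length-++ P) (cong (length P +_) (length-map _ Q))

length-*̲ : ∀ P Q → length (P *̲ Q) ≡ length P + length Q
length-*̲ P Q with last P | last Q
... | just a  | just b  = trans (length-++ P) (cong (length P +_)
                            (trans (length-map _ (shift (length P) Q)) (length-map _ Q)))
... | just _  | nothing = length-* P Q
... | nothing | _       = length-* P Q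

last-* : ∀ P Q {b} → last Q ≡ just b → last (P * Q) ≡ just (length P + b)
last-* P Q eb = last-++ P (last-shift (length P) Q eb)

last-*̲ : ∀ P Q {a} → last P ≡ just a → last (P *̲ Q) ≡ just a
last-*̲ P [] ea = trans (cong last (*̲-identityʳ P)) ea
last-*̲ P (q ∷ Q) {a} ea with last-∷ q Q
... | b , eb = trans (cong last (*̲-unfold P (q ∷ Q) ea eb)) (last-++ P relabelled-last)
  where
  p = length P
  relabelled-last : last (relabel (p + b) a (shift p (q ∷ Q))) ≡ just a
  relabelled-last = begin
    last (relabel (p + b) a (shift p (q ∷ Q)))            ≡⟨ last-map _ (shift p (q ∷ Q)) ⟩
    Maybe.map (rename (p + b) a) (last (shift p (q ∷ Q))) ≡⟨ cong (Maybe.map _) (last-shift p (q ∷ Q) eb) ⟩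
    just (rename (p + b) a (p + b))                       ≡⟨ cong just (rename-self (p + b) a) ⟩
    just a                                                ∎

*-assoc : ∀ P Q R → (P * Q) * R ≡ P * (Q * R)
*-assoc P Q R = begin
  (P ++ shift p Q) ++ shift (length (P * Q)) R     ≡⟨ cong (λ n → (P ++ shift p Q) ++ shift n R) (length-* P Q) ⟩
  (P ++ shift p Q) ++ shift (p + length Q) R       ≡⟨ ++-assoc P (shift p Q) _ ⟩
  P ++ (shift p Q ++ shift (p + length Q) R)       ≡⟨ cong (λ X → P ++ (shift p Q ++ X)) (sym (shift-shift p _ R)) ⟩
  P ++ (shift p Q ++ shift p (shift (length Q) R)) ≡⟨ cong (P ++_) (sym (map-++ (p +_) Q _)) ⟩
  P * (Q * R)                                      ∎
  where p = length P

*-*̲-assoc : ∀ P {Q b} R → last Q ≡ just b → (P * Q) *̲ R ≡ P * (Q *̲ R)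
*-*̲-assoc P {Q} [] eb = trans (*̲-identityʳ (P * Q)) (cong (P *_) (sym (*̲-identityʳ Q)))
*-*̲-assoc P {Q} {b} R@(r ∷ rs) eb with last-∷ r rs
... | c , ec = begin
  (P * Q) *̲ R
    ≡⟨ *̲-unfold (P * Q) R (last-* P Q eb) ec ⟩
  (P * Q) ++ relabel (length (P * Q) + c) (p + b) (shift (length (P * Q)) R)
    ≡⟨ cong (λ n → (P * Q) ++ relabel (n + c) (p + b) (shift n R)) (length-* P Q) ⟩
  (P ++ shift p Q) ++ relabel (p + q + c) (p + b) (shift (p + q) R)
    ≡⟨ ++-assoc P (shift p Q) _ ⟩
  P ++ (shift p Q ++ relabel (p + q + c) (p + b) (shift (p + q) R))
    ≡⟨ cong (λ X → P ++ (shift p Q ++ X)) (sym (shift-relabel-shift p q b c R)) ⟩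
  P ++ (shift p Q ++ shift p (relabel (q + c) b (shift q R)))
    ≡⟨ cong (P ++_) (sym (map-++ (p +_) Q _)) ⟩
  P * (Q ++ relabel (q + c) b (shift q R))
    ≡⟨ cong (P *_) (sym (*̲-unfold Q R eb ec)) ⟩
  P * (Q *̲ R) ∎
  where p = length P
        q = length Q

InRange : ℕ → ℕ → Set
InRange n x = 0 < x × x ≤ n

Bounded : ℕ → List ℕ → Set
Bounded n = All (InRange n)

WellLabelled : Partition → Set
WellLabelled P = Bounded (length P) P

Bounded-weaken : ∀ {m n L} → m ≤ n → Bounded m L → Bounded n L
Bounded-weaken m≤n = All.map (map₂ (λ x≤m → ≤-trans x≤m m≤n))

Bounded-shift : ∀ k {n L} → Bounded n L → Bounded (k + n) (shift k L)
Bounded-shift k = map⁺ ∘ All.map (λ {x} (0<x , x≤n) → ≤-trans 0<x (m≤n+m x k) , +-monoʳ-≤ k x≤n)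

Bounded-relabel : ∀ b {a n L} → InRange n a → Bounded n L → Bounded n (relabel b a L)
Bounded-relabel b {a} {n} a∈ = map⁺ ∘ All.map renamed
  where
  renamed : ∀ {x} → InRange n x → InRange n (rename b a x)
  renamed {x} x∈ with x ≡ᵇ b
  ... | true  = a∈
  ... | false = x∈

WellLabelled-* : ∀ P Q → WellLabelled P → WellLabelled Q → WellLabelled (P * Q)
WellLabelled-* P Q wP wQ rewrite length-* P Q =
  ++⁺ (Bounded-weaken (m≤m+n _ _) wP) (Bounded-shift (length P) wQ)

WellLabelled-*̲ : ∀ P Q → WellLabelled P → WellLabelled Q → WellLabelled (P *̲ Q)
WellLabelled-*̲ P [] wP _ rewrite *̲-identityʳ P = wP
WellLabelled-*̲ [] Q _ wQ rewrite *̲-identityˡ Q = wQ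
WellLabelled-*̲ P@(x ∷ xs) Q@(y ∷ ys) wP wQ with last-∷ x xs | last-∷ y ys
... | a , ea | b , eb rewrite length-*̲ P Q | *̲-unfold P Q ea eb =
  ++⁺ wP′ (Bounded-relabel _ (All-last wP′ ea) (Bounded-shift (length P) wQ))
  where wP′ = Bounded-weaken (m≤m+n _ _) wP

WellLabelled-φ : ∀ t → WellLabelled (φ t)
WellLabelled-φ leaf    = []
WellLabelled-φ (σ ∨ τ) =
  WellLabelled-* (φ σ) _ (WellLabelled-φ σ)
    (WellLabelled-*̲ ∣ₚ (φ τ) ((s≤s z≤n , s≤s z≤n) ∷ []) (WellLabelled-φ τ))

*̲-assoc : ∀ P Q R → WellLabelled Q → WellLabelled R → (P *̲ Q) *̲ R ≡ P *̲ (Q *̲ R)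
*̲-assoc P Q [] _ _ = trans (*̲-identityʳ (P *̲ Q)) (cong (P *̲_) (sym (*̲-identityʳ Q)))
*̲-assoc P [] R _ _ = trans (cong (_*̲ R) (*̲-identityʳ P)) (cong (P *̲_) (sym (*̲-identityˡ R)))
*̲-assoc [] Q R _ _ = trans (cong (_*̲ R) (*̲-identityˡ Q)) (sym (*̲-identityˡ (Q *̲ R)))
*̲-assoc P@(x ∷ xs) Q@(y ∷ ys) R@(z ∷ zs) wQ wR with last-∷ x xs | last-∷ y ys | last-∷ z zs
... | a , ea | b , eb | c , ec = begin
  (P *̲ Q) *̲ R
    ≡⟨ *̲-unfold (P *̲ Q) R (last-*̲ P Q ea) ec ⟩
  (P *̲ Q) ++ relabel (length (P *̲ Q) + c) a (shift (length (P *̲ Q)) R)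
    ≡⟨ cong (λ n → (P *̲ Q) ++ relabel (n + c) a (shift n R)) (length-*̲ P Q) ⟩
  (P *̲ Q) ++ X
    ≡⟨ cong (_++ X) (*̲-unfold P Q ea eb) ⟩
  (P ++ relabel (p + b) a (shift p Q)) ++ X
    ≡⟨ ++-assoc P _ X ⟩
  P ++ (relabel (p + b) a (shift p Q) ++ X)
    ≡⟨ cong (λ Y → P ++ (relabel (p + b) a (shift p Q) ++ Y)) (sym relabel-shifted-merge) ⟩
  P ++ (relabel (p + b) a (shift p Q) ++ relabel (p + b) a (shift p M))
    ≡⟨ cong (P ++_) (sym (map-++ (rename (p + b) a) (shift p Q) _)) ⟩
  P ++ relabel (p + b) a (shift p Q ++ shift p M)
    ≡⟨ cong (λ Y → P ++ relabel (p + b) a Y) (sym (map-++ (p +_) Q M)) ⟩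
  P ++ relabel (p + b) a (shift p (Q ++ M))
    ≡⟨ cong (λ Y → P ++ relabel (p + b) a (shift p Y)) (sym (*̲-unfold Q R eb ec)) ⟩
  P ++ relabel (p + b) a (shift p (Q *̲ R))
    ≡⟨ sym (*̲-unfold P (Q *̲ R) ea (last-*̲ Q R eb)) ⟩
  P *̲ (Q *̲ R) ∎
  where
  p = length P
  q = length Q
  M = relabel (q + c) b (shift q R)
  X = relabel (p + q + c) a (shift (p + q) R)

  shifted-R∌p+b : All (_≢ p + b) (shift (p + q) R)
  shifted-R∌p+b = map⁺ (All.map (λ {r} (0<r , _) →
    >⇒≢ (≤-<-trans (+-monoʳ-≤ p (proj₂ (All-last wQ eb))) (m<m+n (p + q) 0<r))) wR)

  relabel-shifted-merge : relabel (p + b) a (shift p M) ≡ X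
  relabel-shifted-merge = begin
    relabel (p + b) a (shift p M)
      ≡⟨ cong (relabel (p + b) a) (shift-relabel-shift p q b c R) ⟩
    relabel (p + b) a (relabel (p + q + c) (p + b) (shift (p + q) R))
      ≡⟨ relabel-relabel (p + q + c) a shifted-R∌p+b ⟩
    X ∎

φ-/ : ∀ σ τ → φ (σ / τ) ≡ φ σ * φ τ
φ-/ σ leaf          = sym (*-identityʳ (φ σ))
φ-/ σ (leaf ∨ r)    = cong (φ σ *_) (sym (*-identityˡ (∣ₚ *̲ φ r)))
φ-/ σ ((a ∨ b) ∨ r) =
  trans (cong (_* (∣ₚ *̲ φ r)) (φ-/ σ (a ∨ b))) (*-assoc (φ σ) (φ (a ∨ b)) (∣ₚ *̲ φ r))

φ-\\ : ∀ σ τ → φ (σ \\ τ) ≡ φ σ *̲ φ τ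
φ-\\ leaf          τ = sym (*̲-identityˡ (φ τ))
φ-\\ (l ∨ leaf)    τ = sym (*-*̲-assoc (φ l) (φ τ) refl)
φ-\\ (l ∨ (a ∨ b)) τ = begin
  φ l * (∣ₚ *̲ φ ((a ∨ b) \\ τ))   ≡⟨ cong (λ X → φ l * (∣ₚ *̲ X)) (φ-\\ (a ∨ b) τ) ⟩
  φ l * (∣ₚ *̲ (φ (a ∨ b) *̲ φ τ)) ≡⟨ cong (φ l *_) (sym (*̲-assoc ∣ₚ (φ (a ∨ b)) (φ τ)
                                        (WellLabelled-φ (a ∨ b)) (WellLabelled-φ τ))) ⟩
  φ l * ((∣ₚ *̲ φ (a ∨ b)) *̲ φ τ) ≡⟨ sym (*-*̲-assoc (φ l) (φ τ) (last-*̲ ∣ₚ (φ (a ∨ b)) refl)) ⟩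
  φ (l ∨ (a ∨ b)) *̲ φ τ           ∎

lemma2p15 : (σ τ : Tree) →
    (φ (σ / τ) ≡ φ σ * φ τ) × (φ (σ \\ τ) ≡ φ σ *̲ φ τ)
lemma2p15 σ τ = φ-/ σ τ , φ-\\ σ τ
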